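{- Let $\Gamma$ be a commutative quasi-thin weakly distance-regular digraph of valency more than $3$. If $(x_0,x_1,\dots,x_{n-1})$ is an undirected circuit in $\Gamma$, then $\partial(x_0,x_i)=\partial(x_i,x_0)=\partial(x_0,x_{n-i})$ for $1\leq i\leq n-1$.
   Context: All digraphs are finite and simple. $\partial(x,y)$ is the length of a shortest directed path from $x$ to $y$, $\tilde\partial(x,y)=(\partial(x,y),\partial(y,x))$. A strongly connected digraph is weakly distance-regular if for all two-way distances $\tilde h,\tilde i,\tilde j$ the number $p^{\tilde h}_{\tilde i,\tilde j}=|\{z\mid\tilde\partial(x,z)=\tilde i,\tilde\partial(z,y)=\tilde j\}|$ depends only on $\tilde h=\tilde\partial(x,y)$; commutative: $p^{\tilde h}_{\tilde i,\tilde j}=p^{\tilde h}_{\tilde j,\tilde i}$; quasi-thin: maximum intersection number is $2$; valency = out-degree. An arc $(u,v)$ is of type $(1,r)$ if $\partial(v,u)=r$. A path $(w_0,\dots,w_{r-1})$ is a circuit of length $r$ if $\partial(w_{r-1},w_0)=1$; it is undirected if each of its arcs (including $(w_{r-1},w_0)$) is of type $(1,1)$. -}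

module Defs where

open import Data.Nat using (ℕ; zero; suc; _≡ᵇ_)
open import Data.Bool using (Bool; true; false; _∧_; if_then_else_)
open import Data.Fin using (Fin; _≟_)
open import Data.List using (List; length; filterᵇ; allFin)
open import Data.Bool.ListAction using (any)
open import Data.Product using (_×_; _,_; ∃)
open import Relation.Nullary.Decidable using (isYes)
open import Relation.Binary.PropositionalEquality using (_≡_)

record Digraph : Set where
  field
    N     : ℕ
    adj   : Fin N → Fin N → Bool
    loopless : ∀ x → adj x x ≡ false

module _ (Γ : Digraph) where
  open Digraph Γ

  Vertex : Set
  Vertex = Fin N

  count : (Vertex → Bool) → ℕ
  count p = length (filterᵇ p (allFin N))

  walk : ℕ → Vertex → Vertex → Bool
  walk zero x y = isYes (x ≟ y)
  walk (suc k) x y = any (λ z → adj x z ∧ walk k z y) (allFin N)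

  StronglyConnected : Set
  StronglyConnected = ∀ x y → ∃ λ k → walk k x y ≡ true

-- least k < b with f k = true, or b if there is none
least : (ℕ → Bool) → ℕ → ℕ
least f zero = zero
least f (suc b) = if f zero then zero else suc (least (λ k → f (suc k)) b)

module _ (Γ : Digraph) where
  open Digraph Γ

  -- ∂(x,y): length of a shortest directed walk (= path) from x to y.
  -- A shortest walk always has length < N, so searching k < N suffices;
  -- the value N is returned when y is unreachable from x.
  ∂ : Vertex Γ → Vertex Γ → ℕ
  ∂ x y = least (λ k → walk Γ k x y) N

  ∂̃ : Vertex Γ → Vertex Γ → ℕ × ℕ
  ∂̃ x y = ∂ x y , ∂ y x

  eq2 : ℕ × ℕ → ℕ × ℕ → Bool
  eq2 (a , b) (c , d) = (a ≡ᵇ c) ∧ (b ≡ᵇ d)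

  p : Vertex Γ → Vertex Γ → ℕ × ℕ → ℕ × ℕ → ℕ
  p x y i j = count Γ (λ z → eq2 (∂̃ x z) i ∧ eq2 (∂̃ z y) j)

  WeaklyDistanceRegular : Set
  WeaklyDistanceRegular =
    StronglyConnected Γ ×
    (∀ x y x' y' i j → ∂̃ x y ≡ ∂̃ x' y' → p x y i j ≡ p x' y' i j)

  Commutative : Set
  Commutative = ∀ x y i j → p x y i j ≡ p x y j i

  open import Data.Nat using (_≤_; _>_)

  QuasiThin : Set
  QuasiThin = (∀ x y i j → p x y i j ≤ 2) ×
              ∃ λ x → ∃ λ y → ∃ λ i → ∃ λ j → p x y i j ≡ 2

  outdeg : Vertex Γ → ℕ
  outdeg x = count Γ (adj x)

  ValencyGreaterThan3 : Set
  ValencyGreaterThan3 = ∀ x → outdeg x > 3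

  UEdge : Vertex Γ → Vertex Γ → Set
  UEdge u v = (adj u v ≡ true) × (adj v u ≡ true)

open import Data.Fin using (inject₁; fromℕ) renaming (zero to fzero; suc to fsuc)
open import Function.Definitions using (Injective)

-- (w 0, …, w m) is an undirected circuit of length suc m:
-- distinct vertices, each arc (w t, w (t+1)) and the closing arc
-- (w m, w 0) are of type (1,1).
UndirectedCircuit : (Γ : Digraph) (m : ℕ) → (Fin (suc m) → Vertex Γ) → Set
UndirectedCircuit Γ m w =
  Injective _≡_ _≡_ w ×
  (∀ (t : Fin m) → UEdge Γ (w (inject₁ t)) (w (fsuc t))) ×
  UEdge Γ (w (fromℕ m)) (w fzero)

-- Quasi-thinness leaves each vertex x_t of the circuit (positions taken modulo
-- n) with exactly the two (1,1)-neighbours x_(t±1), so p^(∂̃(u,x_t))_(I,(1,1))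
-- counts the occurrences of I among ∂̃(u,x_(t+1)) and ∂̃(u,x_(t-1)).  Weak
-- distance-regularity therefore turns ∂̃(u,x_t) = ∂̃(u',x_d) into an equality of
-- the multisets {∂̃(u,x_(t±1))} and {∂̃(u',x_(d±1))}.  Hence two rows
-- k ↦ ∂̃(u,x_k) agreeing at two consecutive positions agree everywhere, and rows
-- agreeing at one position agree either in the same direction or reflected.
-- The first fact gives rotation invariance ∂̃(x_s,x_(s+k)) = ∂̃(x_0,x_k).  For
-- the reflection ∂̃(x_0,x_a) = ∂̃(x_0,x_(-a)), regularity applied to
-- ∂̃(x_0,x_1) = ∂̃(x_0,x_(-1)) yields z with ∂̃(x_0,z) = ∂̃(x_0,x_a) and
-- ∂̃(z,x_(-1)) = ∂̃(x_a,x_1); comparing the rows of z and x_a gives z = x_(-a)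
-- or z = x_(a-2).  In the latter case the row of x_0 agrees at a-2 and a; a
-- shift by two would force x_0 = x_2, so the row is reflected about a-1, whence
-- x_(a-2) = x_(-a).  Together, ∂̃(x_a,x_0) = ∂̃(x_0,x_(-a)) = ∂̃(x_0,x_a).
module Submission where

open import Defs
open import Data.Nat using (ℕ; suc; _≤_; _+_)
open import Data.Fin using (Fin; toℕ; zero)
open import Data.Product using (_×_)
open import Relation.Binary.PropositionalEquality using (_≡_)

open import Data.Bool using (Bool; true; false; _∧_; not)
open import Data.Bool.Properties using (T-≡; ∧-conicalˡ; ∧-conicalʳ; ∧-identityʳ)
open import Data.Empty using (⊥-elim)
open import Data.Fin using (fromℕ; fromℕ<; inject₁; _≟_) renaming (suc to fsuc)
open import Data.Fin.Properties using (toℕ-injective; toℕ-fromℕ<; toℕ-fromℕ; toℕ-inject₁; toℕ<n; ¬Fin0)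
open import Data.List using (List; []; _∷_; length; filterᵇ; allFin; tabulate)
open import Data.List.Membership.Propositional using (lose)
open import Data.List.Membership.Propositional.Properties using (∈-allFin)
open import Data.List.Relation.Unary.Any.Properties using (any⁺)
open import Data.Nat using (_<_; _*_; _%_; _≡ᵇ_; z≤n; s≤s)
open import Data.Nat.DivMod using (_mod_; [m+kn]%n≡m%n; %-distribˡ-+; m<n⇒m%n≡m; m%n%n≡m%n; m%n<n)
open import Data.Nat.Properties
  using (≡ᵇ⇒≡; ≡⇒≡ᵇ; +-suc; +-identityʳ; +-assoc; *-identityˡ; +-cancelˡ-≡; ≤-<-trans; m<1+n⇒m<n∨m≡n)
import Data.Nat.Properties as ℕ
open import Data.Nat.Tactic.RingSolver using (solve-∀)
open import Data.Product using (_,_; proj₁; proj₂; ∃; swap)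
open import Data.Product.Properties using (≡-dec)
open import Data.Sum using (_⊎_; inj₁; inj₂; [_,_]′) renaming (map to ⊎-map)
open import Function using (_∘_; Equivalence)
open import Relation.Binary.PropositionalEquality
  using (refl; sym; trans; cong; cong₂; subst; subst₂; _≗_; _≢_; module ≡-Reasoning)
open import Relation.Nullary using (¬_; yes; no; does; contradiction)
open import Relation.Nullary.Decidable using (isYes; isYes≗does; dec-true; dec-false; toWitness)

open Equivalence using (to; from)
open ≡-Reasoning

χ : Bool → ℕ
χ true  = 1
χ false = 0

χ-true : ∀ {b k} → suc k ≡ χ b → b ≡ true
χ-true {true} _ = refl

module _ {A : Set} where

  countᵇ : (A → Bool) → List A → ℕ
  countᵇ P xs = length (filterᵇ P xs)

  countᵇ-∷ : ∀ (P : A → Bool) x xs → countᵇ P (x ∷ xs) ≡ χ (P x) + countᵇ P xs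
  countᵇ-∷ P x xs with P x
  ... | true  = refl
  ... | false = refl

  countᵇ-none : ∀ {P : A → Bool} → (∀ z → P z ≡ false) → ∀ xs → countᵇ P xs ≡ 0
  countᵇ-none none [] = refl
  countᵇ-none none (x ∷ xs) rewrite none x = countᵇ-none none xs

  countᵇ-split : ∀ (Q P : A → Bool) xs →
    countᵇ P xs ≡ countᵇ (λ z → Q z ∧ P z) xs + countᵇ (λ z → not (Q z) ∧ P z) xs
  countᵇ-split Q P [] = refl
  countᵇ-split Q P (x ∷ xs) with Q x | P x
  ... | true  | true  = cong suc (countᵇ-split Q P xs)
  ... | false | true  = trans (cong suc (countᵇ-split Q P xs)) (sym (+-suc _ _))
  ... | true  | false = countᵇ-split Q P xs
  ... | false | false = countᵇ-split Q P xs

  countᵇ-witness : ∀ (P : A → Bool) xs → 0 < countᵇ P xs → ∃ λ z → P z ≡ true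
  countᵇ-witness P [] ()
  countᵇ-witness P (x ∷ xs) pos with P x in Px
  ... | true  = x , Px
  ... | false = countᵇ-witness P xs pos

countᵇ-tabulate : ∀ {A : Set} {n} (P : A → Bool) (f : Fin n → A) →
  countᵇ P (tabulate f) ≡ countᵇ (P ∘ f) (allFin n)
countᵇ-tabulate {n = 0}     P f = refl
countᵇ-tabulate {n = suc n} P f = begin
  countᵇ P (tabulate f)                              ≡⟨ countᵇ-∷ P (f zero) _ ⟩
  χ (P (f zero)) + countᵇ P (tabulate (f ∘ fsuc))    ≡⟨ cong (χ (P (f zero)) +_) tail ⟩
  χ (P (f zero)) + countᵇ (P ∘ f) (tabulate fsuc)    ≡⟨ countᵇ-∷ (P ∘ f) zero _ ⟨
  countᵇ (P ∘ f) (allFin (suc n))                    ∎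
  where
  tail : countᵇ P (tabulate (f ∘ fsuc)) ≡ countᵇ (P ∘ f) (tabulate fsuc)
  tail = trans (countᵇ-tabulate P (f ∘ fsuc)) (sym (countᵇ-tabulate (P ∘ f) fsuc))

countᵇ-at : ∀ {n} (P : Fin n → Bool) a → countᵇ (λ z → does (z ≟ a) ∧ P z) (allFin n) ≡ χ (P a)
countᵇ-at {suc n} P zero = begin
  countᵇ Q (allFin (suc n))              ≡⟨ countᵇ-∷ Q zero _ ⟩
  χ (P zero) + countᵇ Q (tabulate fsuc)  ≡⟨ cong (χ (P zero) +_) none ⟩
  χ (P zero) + 0                         ≡⟨ +-identityʳ _ ⟩
  χ (P zero)                             ∎
  where
  Q : Fin (suc n) → Bool
  Q z = does (z ≟ zero) ∧ P z
  none : countᵇ Q (tabulate fsuc) ≡ 0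
  none = trans (countᵇ-tabulate Q fsuc) (countᵇ-none (λ _ → refl) (allFin n))
countᵇ-at {suc n} P (fsuc a) =
  trans (countᵇ-tabulate (λ z → does (z ≟ fsuc a) ∧ P z) fsuc) (countᵇ-at (P ∘ fsuc) a)

module _ {n : ℕ} where

  countᵇ-remove : ∀ (P : Fin n → Bool) a →
    countᵇ P (allFin n) ≡ χ (P a) + countᵇ (λ z → not (does (z ≟ a)) ∧ P z) (allFin n)
  countᵇ-remove P a =
    trans (countᵇ-split (λ z → does (z ≟ a)) P (allFin n)) (cong (_+ countᵇ P₋ₐ (allFin n)) (countᵇ-at P a))
    where
    P₋ₐ : Fin n → Bool
    P₋ₐ z = not (does (z ≟ a)) ∧ P z

  countᵇ-pos : ∀ (P : Fin n → Bool) a → P a ≡ true → 0 < countᵇ P (allFin n)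
  countᵇ-pos P a Pa rewrite countᵇ-remove P a | Pa = s≤s z≤n

  3≤countᵇ : ∀ (P : Fin n → Bool) a b c → P a ≡ true → P b ≡ true → P c ≡ true →
    b ≢ a → c ≢ a → c ≢ b → 3 ≤ countᵇ P (allFin n)
  3≤countᵇ P a b c Pa Pb Pc b≢a c≢a c≢b
    rewrite countᵇ-remove P a | Pa
          | countᵇ-remove (λ z → not (does (z ≟ a)) ∧ P z) b | dec-false (b ≟ a) b≢a | Pb
    = s≤s (s≤s (countᵇ-pos _ c Pc′))
    where
    Pc′ : not (does (c ≟ b)) ∧ (not (does (c ≟ a)) ∧ P c) ≡ true
    Pc′ rewrite dec-false (c ≟ b) c≢b | dec-false (c ≟ a) c≢a = Pc

  countᵇ-pair : ∀ (P : Fin n → Bool) a b → b ≢ a → (∀ z → P z ≡ true → z ≡ a ⊎ z ≡ b) →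
    countᵇ P (allFin n) ≡ χ (P a) + χ (P b)
  countᵇ-pair P a b b≢a only = begin
    countᵇ P (allFin n)                              ≡⟨ countᵇ-remove P a ⟩
    χ (P a) + countᵇ P₋ₐ (allFin n)                  ≡⟨ cong (χ (P a) +_) (countᵇ-remove P₋ₐ b) ⟩
    χ (P a) + (χ (P₋ₐ b) + countᵇ P₋ₐ₋ᵦ (allFin n))  ≡⟨ cong₂ (λ u v → χ (P a) + (χ (not u ∧ P b) + v))
                                                              (dec-false (b ≟ a) b≢a) (countᵇ-none none (allFin n)) ⟩
    χ (P a) + (χ (P b) + 0)                          ≡⟨ cong (χ (P a) +_) (+-identityʳ _) ⟩
    χ (P a) + χ (P b)                                ∎
    where
    P₋ₐ P₋ₐ₋ᵦ : Fin n → Bool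
    P₋ₐ z = not (does (z ≟ a)) ∧ P z
    P₋ₐ₋ᵦ z = not (does (z ≟ b)) ∧ P₋ₐ z
    none : ∀ z → P₋ₐ₋ᵦ z ≡ false
    none z with z ≟ b | z ≟ a | P z in Pz
    ... | yes _   | _       | _     = refl
    ... | no _    | yes _   | _     = refl
    ... | no _    | no _    | false = refl
    ... | no z≢b  | no z≢a  | true  with only z Pz
    ...   | inj₁ z≡a = contradiction z≡a z≢a
    ...   | inj₂ z≡b = contradiction z≡b z≢b

-- `eq2 Γ`, through which `p` compares two-way distances, unfolds to `_=ᵇ_`.
_=ᵇ_ : ℕ × ℕ → ℕ × ℕ → Bool
(a , b) =ᵇ (c , d) = (a ≡ᵇ c) ∧ (b ≡ᵇ d)

=ᵇ-refl : ∀ A → (A =ᵇ A) ≡ true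
=ᵇ-refl (a , b) = cong₂ _∧_ (to T-≡ (≡⇒≡ᵇ a a refl)) (to T-≡ (≡⇒≡ᵇ b b refl))

=ᵇ⇒≡ : ∀ A B → (A =ᵇ B) ≡ true → A ≡ B
=ᵇ⇒≡ (a , b) (c , d) eq =
  cong₂ _,_ (≡ᵇ⇒≡ a c (from T-≡ (∧-conicalˡ _ _ eq))) (≡ᵇ⇒≡ b d (from T-≡ (∧-conicalʳ _ _ eq)))

≢⇒=ᵇ-false : ∀ {A B} → A ≢ B → (A =ᵇ B) ≡ false
≢⇒=ᵇ-false {A} {B} A≢B with A =ᵇ B in eq
... | true  = contradiction (=ᵇ⇒≡ A B eq) A≢B
... | false = refl

-- The multiset {A , B}, given by its multiplicity function.
⟅_,_⟆ : ℕ × ℕ → ℕ × ℕ → ℕ × ℕ → ℕ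
⟅ A , B ⟆ I = χ (A =ᵇ I) + χ (B =ᵇ I)

⟅⟆-comm : ∀ {A B} → ⟅ A , B ⟆ ≗ ⟅ B , A ⟆
⟅⟆-comm {A} {B} I = ℕ.+-comm (χ (A =ᵇ I)) (χ (B =ᵇ I))

⟅⟆-injective : ∀ {A B C D} → ⟅ A , B ⟆ ≗ ⟅ C , D ⟆ → (A ≡ C × B ≡ D) ⊎ (A ≡ D × B ≡ C)
⟅⟆-injective {A} {B} {C} {D} eq with ≡-dec ℕ._≟_ ℕ._≟_ A C
... | yes refl = inj₁ (refl , sym (=ᵇ⇒≡ D B (χ-true (+-cancelˡ-≡ (χ (A =ᵇ B)) _ _ at-B))))
  where
  at-B : χ (A =ᵇ B) + 1 ≡ χ (A =ᵇ B) + χ (D =ᵇ B)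
  at-B = subst (λ e → χ (A =ᵇ B) + χ e ≡ χ (A =ᵇ B) + χ (D =ᵇ B)) (=ᵇ-refl B) (eq B)
... | no A≢C = inj₂ (sym D≡A , B≡C)
  where
  C≠A : (C =ᵇ A) ≡ false
  C≠A = ≢⇒=ᵇ-false (A≢C ∘ sym)
  D≡A : D ≡ A
  D≡A = =ᵇ⇒≡ D A (χ-true (begin
    suc (χ (B =ᵇ A))  ≡⟨ cong (λ e → χ e + χ (B =ᵇ A)) (=ᵇ-refl A) ⟨
    ⟅ A , B ⟆ A       ≡⟨ eq A ⟩
    ⟅ C , D ⟆ A       ≡⟨ cong (λ e → χ e + χ (D =ᵇ A)) C≠A ⟩
    χ (D =ᵇ A)        ∎))
  B≡C : B ≡ C
  B≡C = =ᵇ⇒≡ B C (χ-true (begin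
    1            ≡⟨ cong₂ (λ e f → χ e + χ f) (=ᵇ-refl C) (trans (cong (_=ᵇ C) D≡A) (≢⇒=ᵇ-false A≢C)) ⟨
    ⟅ C , D ⟆ C  ≡⟨ eq C ⟨
    ⟅ A , B ⟆ C  ≡⟨ cong (λ e → χ e + χ (B =ᵇ C)) (≢⇒=ᵇ-false A≢C) ⟩
    χ (B =ᵇ C)   ∎))

⟅⟆-cancelʳ : ∀ {A B C D} → ⟅ A , B ⟆ ≗ ⟅ C , D ⟆ → B ≡ D → A ≡ C
⟅⟆-cancelʳ eq B≡D with ⟅⟆-injective eq
... | inj₁ (A≡C , _)   = A≡C
... | inj₂ (A≡D , B≡C) = trans A≡D (trans (sym B≡D) B≡C)

⟅⟆-recurrence : ∀ (f g : ℕ → ℕ × ℕ) → f 0 ≡ g 0 → f 1 ≡ g 1 →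
  (∀ k → f (suc k) ≡ g (suc k) → ⟅ f (2 + k) , f k ⟆ ≗ ⟅ g (2 + k) , g k ⟆) →
  ∀ k → f k ≡ g k
⟅⟆-recurrence f g e₀ e₁ step k = proj₁ (consecutive k)
  where
  consecutive : ∀ k → f k ≡ g k × f (suc k) ≡ g (suc k)
  consecutive 0       = e₀ , e₁
  consecutive (suc k) with consecutive k
  ... | eₖ , eₖ₊₁ = eₖ₊₁ , ⟅⟆-cancelʳ (step k eₖ₊₁) eₖ

isYes-refl : ∀ {k} (y : Fin k) → isYes (y ≟ y) ≡ true
isYes-refl y = trans (isYes≗does (y ≟ y)) (dec-true (y ≟ y) refl)

least≡0 : ∀ {f} b → f 0 ≡ true → least f b ≡ 0
least≡0 0       _  = refl
least≡0 (suc b) f0 rewrite f0 = refl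

least≡0⇒ : ∀ {f} b → least f b ≡ 0 → b ≡ 0 ⊎ f 0 ≡ true
least≡0⇒     0       _  = inj₁ refl
least≡0⇒ {f} (suc b) eq with f 0
... | true  = inj₂ refl
... | false = contradiction eq λ ()

least≡1 : ∀ {f} b → 0 < b → f 0 ≡ false → f 1 ≡ true → least f b ≡ 1
least≡1 1             _ f0 _  rewrite f0 = refl
least≡1 (suc (suc b)) _ f0 f1 rewrite f0 | f1 = refl

module Distances (Γ : Digraph) where
  open Digraph Γ

  ∂̃-refl : ∀ x → ∂̃ Γ x x ≡ (0 , 0)
  ∂̃-refl x = cong₂ _,_ ∂≡0 ∂≡0
    where
    ∂≡0 : ∂ Γ x x ≡ 0
    ∂≡0 = least≡0 N (isYes-refl x)

  ∂̃≡0⇒≡ : ∀ {x y} → ∂̃ Γ x y ≡ (0 , 0) → x ≡ y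
  ∂̃≡0⇒≡ {x} {y} eq with least≡0⇒ N (cong proj₁ eq)
  ... | inj₁ N≡0  = ⊥-elim (¬Fin0 (subst Fin N≡0 x))
  ... | inj₂ walk = toWitness (from T-≡ walk)

  UEdge⇒≢ : ∀ {x y} → UEdge Γ x y → x ≢ y
  UEdge⇒≢ {x} (xy , _) refl = contradiction (trans (sym xy) (loopless x)) λ ()

  arc⇒∂≡1 : ∀ {x y} → adj x y ≡ true → x ≢ y → ∂ Γ x y ≡ 1
  arc⇒∂≡1 {x} {y} xy x≢y =
    least≡1 N (≤-<-trans z≤n (toℕ<n x)) (trans (isYes≗does (x ≟ y)) (dec-false (x ≟ y) x≢y)) walk₁
    where
    walk₁ : walk Γ 1 x y ≡ true
    walk₁ = to T-≡ (any⁺ _ (lose (∈-allFin y) (from T-≡ (cong₂ _∧_ xy (isYes-refl y)))))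

  UEdge⇒∂̃≡1 : ∀ {x y} → UEdge Γ x y → ∂̃ Γ x y ≡ (1 , 1)
  UEdge⇒∂̃≡1 {x} {y} e@(xy , yx) = cong₂ _,_ (arc⇒∂≡1 xy x≢y) (arc⇒∂≡1 yx (x≢y ∘ sym))
    where
    x≢y : x ≢ y
    x≢y = UEdge⇒≢ e

  p-witness : WeaklyDistanceRegular Γ → ∀ {x y x′ y′} → ∂̃ Γ x y ≡ ∂̃ Γ x′ y′ → ∀ v →
    ∃ λ z → ∂̃ Γ x′ z ≡ ∂̃ Γ x v × ∂̃ Γ z y′ ≡ ∂̃ Γ v y
  p-witness (_ , regular) {x} {y} {x′} {y′} eq v =
    let z , Pz = countᵇ-witness (P x′ y′) (allFin N) (subst (0 <_) (regular x y x′ y′ I J eq) v-counted)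
    in z , =ᵇ⇒≡ _ _ (∧-conicalˡ _ _ Pz) , =ᵇ⇒≡ _ _ (∧-conicalʳ (∂̃ Γ x′ z =ᵇ I) _ Pz)
    where
    I = ∂̃ Γ x v
    J = ∂̃ Γ v y
    P : Vertex Γ → Vertex Γ → Vertex Γ → Bool
    P s t z = (∂̃ Γ s z =ᵇ I) ∧ (∂̃ Γ z t =ᵇ J)
    v-counted : 0 < p Γ x y I J
    v-counted = countᵇ-pos (P x y) v (cong₂ _∧_ (=ᵇ-refl I) (=ᵇ-refl J))

  record UndirectedNeighbourhood (x a b : Vertex Γ) : Set where
    field
      distinct : b ≢ a
      first    : ∂̃ Γ x a ≡ (1 , 1)
      second   : ∂̃ Γ x b ≡ (1 , 1)
      only     : ∀ z → ∂̃ Γ x z ≡ (1 , 1) → z ≡ a ⊎ z ≡ b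

  quasiThin⇒neighbourhood : QuasiThin Γ → ∀ {x a b} → b ≢ a →
    ∂̃ Γ x a ≡ (1 , 1) → ∂̃ Γ x b ≡ (1 , 1) → UndirectedNeighbourhood x a b
  quasiThin⇒neighbourhood (thin , _) {x} {a} {b} b≢a xa xb = record
    { distinct = b≢a ; first = xa ; second = xb ; only = only }
    where
    P : Vertex Γ → Bool
    P z = (∂̃ Γ x z =ᵇ (1 , 1)) ∧ (∂̃ Γ z x =ᵇ (1 , 1))
    P-holds : ∀ {z} → ∂̃ Γ x z ≡ (1 , 1) → P z ≡ true
    P-holds xz = cong (λ D → (D =ᵇ (1 , 1)) ∧ (swap D =ᵇ (1 , 1))) xz
    only : ∀ z → ∂̃ Γ x z ≡ (1 , 1) → z ≡ a ⊎ z ≡ b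
    only z xz with z ≟ a | z ≟ b
    ... | yes z≡a | _       = inj₁ z≡a
    ... | no _    | yes z≡b = inj₂ z≡b
    ... | no z≢a  | no z≢b  = contradiction (thin x x (1 , 1) (1 , 1))
      (ℕ.<⇒≱ (3≤countᵇ P a b z (P-holds xa) (P-holds xb) (P-holds xz) b≢a z≢a z≢b))

  p-via-neighbourhood : ∀ {y a b} → UndirectedNeighbourhood y a b → ∀ x I →
    p Γ x y I (1 , 1) ≡ ⟅ ∂̃ Γ x a , ∂̃ Γ x b ⟆ I
  p-via-neighbourhood {y} {a} {b} nbhd x I = begin
    countᵇ P (allFin N)  ≡⟨ countᵇ-pair P a b distinct (λ z Pz → only z (cong swap (toward-y z Pz))) ⟩
    χ (P a) + χ (P b)    ≡⟨ cong₂ _+_ (cong χ (P-at first)) (cong χ (P-at second)) ⟩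
    ⟅ ∂̃ Γ x a , ∂̃ Γ x b ⟆ I ∎
    where
    open UndirectedNeighbourhood nbhd
    P : Vertex Γ → Bool
    P z = (∂̃ Γ x z =ᵇ I) ∧ (∂̃ Γ z y =ᵇ (1 , 1))
    toward-y : ∀ z → P z ≡ true → ∂̃ Γ z y ≡ (1 , 1)
    toward-y z Pz = =ᵇ⇒≡ _ _ (∧-conicalʳ (∂̃ Γ x z =ᵇ I) _ Pz)
    P-at : ∀ {z} → ∂̃ Γ y z ≡ (1 , 1) → P z ≡ (∂̃ Γ x z =ᵇ I)
    P-at {z} yz = trans (cong (λ D → (∂̃ Γ x z =ᵇ I) ∧ (swap D =ᵇ (1 , 1))) yz) (∧-identityʳ _)

module Circuit (Γ : Digraph) (wdr : WeaklyDistanceRegular Γ) (qt : QuasiThin Γ)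
               (m : ℕ) (w : Fin (3 + m) → Vertex Γ) (circuit : UndirectedCircuit Γ (2 + m) w) where

  open Distances Γ

  n n-1 : ℕ
  n   = 3 + m
  n-1 = 2 + m

  -- Positions are read modulo n, so n-1 + s is the position before s.  The
  -- definition is opaque so that unification can solve for positions.
  opaque
    x : ℕ → Vertex Γ
    x k = w (k mod n)

  opaque
    unfolding x

    x-congruent : ∀ {a b} → a % n ≡ b % n → x a ≡ x b
    x-congruent eq = cong w (toℕ-injective (trans (toℕ-fromℕ< _) (trans eq (sym (toℕ-fromℕ< _)))))

    x-injective : ∀ {a b} → x a ≡ x b → a % n ≡ b % n
    x-injective eq = trans (sym (toℕ-fromℕ< _)) (trans (cong toℕ (proj₁ circuit eq)) (toℕ-fromℕ< _))

    x-toℕ : ∀ f → x (toℕ f) ≡ w f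
    x-toℕ f = cong w (toℕ-injective (trans (toℕ-fromℕ< _) (m<n⇒m%n≡m (toℕ<n f))))

  x-periodic : ∀ {a b} k → a ≡ b + k * n → x a ≡ x b
  x-periodic {b = b} k refl = x-congruent ([m+kn]%n≡m%n b k n)

  x-+ˡ : ∀ {a b} r → x a ≡ x b → x (r + a) ≡ x (r + b)
  x-+ˡ {a} {b} r eq = x-congruent (begin
    (r + a) % n          ≡⟨ %-distribˡ-+ r a n ⟩
    (r % n + a % n) % n  ≡⟨ cong (λ e → (r % n + e) % n) (x-injective eq) ⟩
    (r % n + b % n) % n  ≡⟨ %-distribˡ-+ r b n ⟨
    (r + b) % n          ∎)

  x-cancelˡ : ∀ {a b c} → x (a + b) ≡ x (a + c) → x b ≡ x c
  x-cancelˡ {a} {b} {c} eq = begin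
    x b                      ≡⟨ x-periodic a (shift m a b) ⟨
    x (a * n-1 + (a + b))    ≡⟨ x-+ˡ (a * n-1) eq ⟩
    x (a * n-1 + (a + c))    ≡⟨ x-periodic a (shift m a c) ⟩
    x c                      ∎
    where
    shift : ∀ m a e → a * (2 + m) + (a + e) ≡ e + a * (3 + m)
    shift = solve-∀

  x-+2≢ : ∀ s → x (s + 2) ≢ x s
  x-+2≢ s eq with x-injective (x-cancelˡ {s} (trans eq (cong x (sym (+-identityʳ s)))))
  ... | ()

  x-pred-suc : ∀ s → x (n-1 + suc s) ≡ x s
  x-pred-suc s = x-periodic 1 (index m s)
    where
    index : ∀ m s → (2 + m) + suc s ≡ s + 1 * (3 + m)
    index = solve-∀

  x-suc-pred : ∀ s → x (suc (n-1 + s)) ≡ x s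
  x-suc-pred s = x-periodic 1 (index m s)
    where
    index : ∀ m s → suc ((2 + m) + s) ≡ s + 1 * (3 + m)
    index = solve-∀

  x-step : ∀ s → UEdge Γ (x s) (x (suc s))
  x-step s = subst₂ (UEdge Γ) (sym x-s) (sym (x-+ˡ 1 x-s)) (step-< (s % n) (m%n<n s n))
    where
    x-s : x s ≡ x (s % n)
    x-s = x-congruent (sym (m%n%n≡m%n s n))
    x≡w : ∀ {r} f → toℕ f ≡ r → x r ≡ w f
    x≡w f refl = x-toℕ f
    step-< : ∀ r → r < n → UEdge Γ (x r) (x (suc r))
    step-< r r<n with m<1+n⇒m<n∨m≡n r<n
    ... | inj₁ r<n-1 = subst₂ (UEdge Γ) (sym (x≡w (inject₁ t) (trans (toℕ-inject₁ t) (toℕ-fromℕ< r<n-1))))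
                                        (sym (x≡w (fsuc t) (cong suc (toℕ-fromℕ< r<n-1))))
                                        (proj₁ (proj₂ circuit) t)
      where t = fromℕ< r<n-1
    ... | inj₂ refl  = subst₂ (UEdge Γ) (sym (x≡w (fromℕ n-1) (toℕ-fromℕ n-1)))
                                        (sym (trans (x-periodic 1 (sym (+-identityʳ n))) (x-toℕ zero)))
                                        (proj₂ (proj₂ circuit))

  ∂̃-succ : ∀ s → ∂̃ Γ (x s) (x (suc s)) ≡ (1 , 1)
  ∂̃-succ s = UEdge⇒∂̃≡1 (x-step s)

  ∂̃-pred : ∀ s → ∂̃ Γ (x s) (x (n-1 + s)) ≡ (1 , 1)
  ∂̃-pred s = cong swap (trans (cong (∂̃ Γ (x (n-1 + s))) (sym (x-suc-pred s))) (∂̃-succ (n-1 + s)))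

  neighbourhood : ∀ t → UndirectedNeighbourhood (x t) (x (suc t)) (x (n-1 + t))
  neighbourhood t = quasiThin⇒neighbourhood qt distinct (∂̃-succ t) (∂̃-pred t)
    where
    index : ∀ m t → (2 + m + t) + 2 ≡ suc t + 1 * (3 + m)
    index = solve-∀
    distinct : x (n-1 + t) ≢ x (suc t)
    distinct eq = x-+2≢ (n-1 + t) (trans (x-periodic 1 (index m t)) (sym eq))

  row : Vertex Γ → ℕ → ℕ × ℕ
  row u t = ∂̃ Γ u (x t)

  row-periodic : ∀ u {a b} k → a ≡ b + k * n → row u a ≡ row u b
  row-periodic u k eq = cong (∂̃ Γ u) (x-periodic k eq)

  ≡-from-row : ∀ {u e v c} → row u e ≡ ∂̃ Γ v (x c) → x c ≡ v → u ≡ x e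
  ≡-from-row eq refl = ∂̃≡0⇒≡ (trans eq (∂̃-refl _))

  around : Vertex Γ → ℕ → ℕ × ℕ → ℕ
  around u t = ⟅ row u (suc t) , row u (n-1 + t) ⟆

  transfer : ∀ {u t u′ d} → row u t ≡ row u′ d → around u t ≗ around u′ d
  transfer {u} {t} {u′} {d} eq I = begin
    around u t I            ≡⟨ p-via-neighbourhood (neighbourhood t) u I ⟨
    p Γ u (x t) I (1 , 1)   ≡⟨ proj₂ wdr u (x t) u′ (x d) I (1 , 1) eq ⟩
    p Γ u′ (x d) I (1 , 1)  ≡⟨ p-via-neighbourhood (neighbourhood d) u′ I ⟩
    around u′ d I           ∎

  -- σ walks around the circuit without turning back: σ k and σ (2 + k) are
  -- the two neighbours of σ (suc k).
  Straight : (ℕ → ℕ) → Set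
  Straight σ = ∀ u k → ⟅ row u (σ (2 + k)) , row u (σ k) ⟆ ≗ around u (σ (suc k))

  forward : ∀ t → Straight (_+ t)
  forward t u k I = cong (λ B → ⟅ row u (2 + k + t) , B ⟆ I) (cong (∂̃ Γ u) (sym (x-pred-suc (k + t))))

  -- k * n-1 + d is the position k steps before d.
  backward : ∀ d → Straight (λ k → k * n-1 + d)
  backward d u k I = trans (⟅⟆-comm {row u ((2 + k) * n-1 + d)} {row u (k * n-1 + d)} I)
    (cong₂ (λ A B → ⟅ A , B ⟆ I) (sym (row-periodic u 1 (index m k d))) (cong (row u) (+-assoc n-1 (suc k * n-1) d)))
    where
    index : ∀ m k d → suc ((2 + m + k * (2 + m)) + d) ≡ (k * (2 + m) + d) + 1 * (3 + m)
    index = solve-∀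

  rows-follow : ∀ {σ τ} → Straight σ → Straight τ → ∀ {u u′} →
    row u (σ 0) ≡ row u′ (τ 0) → row u (σ 1) ≡ row u′ (τ 1) → ∀ k → row u (σ k) ≡ row u′ (τ k)
  rows-follow {σ} {τ} σ-straight τ-straight {u} {u′} e₀ e₁ =
    ⟅⟆-recurrence (row u ∘ σ) (row u′ ∘ τ) e₀ e₁
      λ k eq I → trans (σ-straight u k I) (trans (transfer eq I) (sym (τ-straight u′ k I)))

  aligned-or-reflected : ∀ {u t u′ d} → row u t ≡ row u′ d →
    (∀ k → row u (k + t) ≡ row u′ (k + d)) ⊎ (∀ k → row u (k + t) ≡ row u′ (k * n-1 + d))
  aligned-or-reflected {u} {t} {u′} {d} eq =
    ⊎-map (λ (succ≡succ , _) → rows-follow (forward t) (forward d) eq succ≡succ)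
          (λ (succ≡pred , _) → rows-follow (forward t) (backward d) eq
             (trans succ≡pred (cong (λ e → row u′ (e + d)) (sym (*-identityˡ n-1)))))
          (⟅⟆-injective {row u (suc t)} {row u (n-1 + t)} {row u′ (suc d)} {row u′ (n-1 + d)}
                        (transfer {u} {t} {u′} {d} eq))

  row-rotation : ∀ s d k → row (x s) (k + s) ≡ row (x d) (k + d)
  row-rotation s d = rows-follow (forward s) (forward d)
    (trans (∂̃-refl (x s)) (sym (∂̃-refl (x d)))) (trans (∂̃-succ s) (sym (∂̃-succ d)))

  -- 2 * n-1 + a is two positions before a; a row invariant under that shift
  -- would repeat its value (0 , 0) at 0 at position 2.
  row-not-2-periodic : ∀ a → ¬ (∀ k → row (x 0) (k + (2 * n-1 + a)) ≡ row (x 0) (k + a))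
  row-not-2-periodic a periodic = x-+2≢ 0 (sym (begin
    x 0                  ≡⟨ ≡-from-row (sym (periodic k)) (x-periodic (2 + a) (index₁ m a)) ⟩
    x (k + a)            ≡⟨ x-periodic a (index₂ m a) ⟩
    x 2                  ∎))
    where
    k = 2 + a * n-1
    index₁ : ∀ m a → (2 + a * (2 + m)) + (2 * (2 + m) + a) ≡ 0 + (2 + a) * (3 + m)
    index₁ = solve-∀
    index₂ : ∀ m a → (2 + a * (2 + m)) + a ≡ 2 + a * (3 + m)
    index₂ = solve-∀

  reflection-two-back : ∀ a → (∀ k → row (x 0) (k + (2 * n-1 + a)) ≡ row (x 0) (k * n-1 + a)) →
    x (2 * n-1 + a) ≡ x (a * n-1)
  reflection-two-back a reflected = x-cancelˡ {a} (begin
    x (a + (2 * n-1 + a))  ≡⟨ ≡-from-row (reflected a) (x-periodic a (trans (ℕ.+-comm (a * n-1) a) (index m a))) ⟨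
    x 0                    ≡⟨ x-periodic a (index m a) ⟨
    x (a + a * n-1)        ∎)
    where
    index : ∀ m a → a + a * (2 + m) ≡ 0 + a * (3 + m)
    index = solve-∀

  reflected-two-back : ∀ a → row (x 0) (2 * n-1 + a) ≡ row (x 0) a → row (x 0) a ≡ row (x 0) (a * n-1)
  reflected-two-back a eq = begin
    row (x 0) a                ≡⟨ eq ⟨
    row (x 0) (2 * n-1 + a)    ≡⟨ cong (∂̃ Γ (x 0)) two-back≡reflected ⟩
    row (x 0) (a * n-1)        ∎
    where
    two-back≡reflected : x (2 * n-1 + a) ≡ x (a * n-1)
    two-back≡reflected = [ ⊥-elim ∘ row-not-2-periodic a , reflection-two-back a ]′ (aligned-or-reflected eq)

  reflection-from-witness : ∀ a z → ∂̃ Γ (x 0) z ≡ row (x 0) a → row z (n-1 + 0) ≡ row (x a) 1 →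
    row (x 0) a ≡ row (x 0) (a * n-1)
  reflection-from-witness a z from-x₀ to-pred = [ z-two-back , z-reflected ]′ (aligned-or-reflected to-pred)
    where
    index₁ : ∀ m a → (a + (2 + m)) + 1 ≡ a + 1 * (3 + m)
    index₁ = solve-∀
    index₂ : ∀ m a → (a + (2 + m)) + ((2 + m) + 0) ≡ (2 * (2 + m) + a) + 0 * (3 + m)
    index₂ = solve-∀
    index₃ : ∀ m a → suc (a * (2 + m)) * (2 + m) + 1 ≡ a + suc (a * suc m) * (3 + m)
    index₃ = solve-∀
    index₄ : ∀ m a → suc (a * (2 + m)) + ((2 + m) + 0) ≡ a * (2 + m) + 1 * (3 + m)
    index₄ = solve-∀
    z-two-back : (∀ k → row z (k + (n-1 + 0)) ≡ row (x a) (k + 1)) → row (x 0) a ≡ row (x 0) (a * n-1)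
    z-two-back aligned = reflected-two-back a (begin
      row (x 0) (2 * n-1 + a)          ≡⟨ row-periodic (x 0) 0 (index₂ m a) ⟨
      row (x 0) (a + n-1 + (n-1 + 0))  ≡⟨ cong (∂̃ Γ (x 0)) (≡-from-row (aligned (a + n-1)) (x-periodic 1 (index₁ m a))) ⟨
      ∂̃ Γ (x 0) z                      ≡⟨ from-x₀ ⟩
      row (x 0) a                      ∎)
    z-reflected : (∀ k → row z (k + (n-1 + 0)) ≡ row (x a) (k * n-1 + 1)) → row (x 0) a ≡ row (x 0) (a * n-1)
    z-reflected reflected = begin
      row (x 0) a                          ≡⟨ from-x₀ ⟨
      ∂̃ Γ (x 0) z                          ≡⟨ cong (∂̃ Γ (x 0)) (≡-from-row (reflected k) (x-periodic (suc (a * suc m)) (index₃ m a))) ⟩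
      row (x 0) (k + (n-1 + 0))            ≡⟨ row-periodic (x 0) 1 (index₄ m a) ⟩
      row (x 0) (a * n-1)                  ∎
      where k = suc (a * n-1)

  row-reflection : ∀ a → row (x 0) a ≡ row (x 0) (a * n-1)
  row-reflection a =
    let z , from-x₀ , to-pred = p-witness wdr (trans (∂̃-succ 0) (sym (∂̃-pred 0))) (x a)
    in reflection-from-witness a z from-x₀ to-pred

  distances : (i j : Fin n) → toℕ i + toℕ j ≡ n →
    (∂ Γ (w zero) (w i) ≡ ∂ Γ (w i) (w zero)) × (∂ Γ (w i) (w zero) ≡ ∂ Γ (w zero) (w j))
  distances i j a+b≡n rewrite sym (x-toℕ zero) | sym (x-toℕ i) | sym (x-toℕ j) =
    cong proj₁ (trans reflect (sym rotate)) , cong proj₁ rotate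
    where
    a = toℕ i
    b = toℕ j
    index : ∀ m a → a + a * (2 + m) ≡ 0 + a * (3 + m)
    index = solve-∀
    x-a+b : x (a + b) ≡ x 0
    x-a+b = x-periodic 1 (trans a+b≡n (sym (+-identityʳ n)))
    reflect : row (x 0) a ≡ row (x 0) b
    reflect = trans (row-reflection a)
      (cong (∂̃ Γ (x 0)) (x-cancelˡ {a} {a * n-1} {b} (trans (x-periodic a (index m a)) (sym x-a+b))))
    rotate : row (x a) 0 ≡ row (x 0) b
    rotate = begin
      row (x a) 0        ≡⟨ cong (∂̃ Γ (x a)) (trans (sym x-a+b) (cong x (ℕ.+-comm a b))) ⟩
      row (x a) (b + a)  ≡⟨ row-rotation a 0 b ⟩
      row (x 0) (b + 0)  ≡⟨ cong (row (x 0)) (+-identityʳ b) ⟩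
      row (x 0) b        ∎

lemma2p3 : (Γ : Digraph) → WeaklyDistanceRegular Γ → Commutative Γ → QuasiThin Γ →
    ValencyGreaterThan3 Γ →
    (m : ℕ) (w : Fin (suc m) → Vertex Γ) → UndirectedCircuit Γ m w →
    (i j : Fin (suc m)) → 1 ≤ toℕ i → toℕ i + toℕ j ≡ suc m →
    (∂ Γ (w zero) (w i) ≡ ∂ Γ (w i) (w zero)) × (∂ Γ (w i) (w zero) ≡ ∂ Γ (w zero) (w j))
lemma2p3 Γ _ _ _ _ 0 w (_ , _ , loop) _ _ _ _ = ⊥-elim (Distances.UEdge⇒≢ Γ loop refl)
lemma2p3 Γ _ _ _ _ 1 w (_ , edges , _) (fsuc zero) (fsuc zero) _ _ =
  trans ∂₀₁ (sym ∂₁₀) , trans ∂₁₀ (sym ∂₀₁)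
  where
  ∂₀₁ : ∂ Γ (w zero) (w (fsuc zero)) ≡ 1
  ∂₀₁ = cong proj₁ (Distances.UEdge⇒∂̃≡1 Γ (edges zero))
  ∂₁₀ : ∂ Γ (w (fsuc zero)) (w zero) ≡ 1
  ∂₁₀ = cong proj₂ (Distances.UEdge⇒∂̃≡1 Γ (edges zero))
lemma2p3 Γ _ _ _ _ 1 w _ zero        zero        _ ()
lemma2p3 Γ _ _ _ _ 1 w _ zero        (fsuc zero) _ ()
lemma2p3 Γ _ _ _ _ 1 w _ (fsuc zero) zero        _ ()
lemma2p3 Γ wdr _ qt _ (suc (suc m)) w circuit i j _ i+j≡n = Circuit.distances Γ wdr qt m w circuit i j i+j≡n
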